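{- Let $G$ be a countably-infinite oriented graph which is weakly-connected, acyclic, locally-finite, and has no infinite directed paths. Then for every vertex $v$ of in-degree $0$ in $G$, $G$ has a $\pm$-partition $\{C_i:i\in\mathbb{N}\}$ with $C_1=\{v\}$, and for every vertex $v$ of out-degree $0$ in $G$, $G$ has a $\mp$-partition $\{C_i:i\in\mathbb{N}\}$ with $C_1=\{v\}$.
   Context: Here $\mathbb{N}=\{1,2,3,\dots\}$ and $C_0=\emptyset$. An oriented graph is weakly-connected if its underlying undirected graph is connected; locally-finite if each vertex is incident with finitely many edges; a directed path is an orientation of a finite, one-way-infinite or two-way-infinite path with no vertex of in-degree 2 or out-degree 2. For a countably-infinite acyclic weakly-connected oriented graph $G$, a $\pm$-partition of $G$ is a partition $\{C_i:i\in\mathbb{N}\}$ of $V(G)$ such that: (1) each $C_i$ is finite and non-empty; (2) for every edge $(u,v)\in E(G)$ there is $i\in\mathbb{N}$ with $\{u,v\}\subseteq C_i\cup C_{i+1}$; (3) if $i$ is odd then every vertex of $C_i$ has no in-neighbours in $C_{i-1}\cup C_{i+1}$, and if $i$ is even then every vertex of $C_i$ has no out-neighbours in $C_{i-1}\cup C_{i+1}$; (4) if $i$ is odd then some vertex of $C_i$ has in-degree $0$ in $G$, and if $i$ is even then some vertex of $C_i$ has out-degree $0$ in $G$. A $\mp$-partition is defined identically with the roles of "in" and "out" interchanged everywhere in (3) and (4). -}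

module Defs where

open import Data.Nat using (ℕ; zero; suc; _%_)
open import Data.Integer using (ℤ) renaming (suc to sucℤ)
open import Data.List using (List)
open import Data.List.Membership.Propositional using (_∈_)
open import Data.Product using (Σ; ∃; _×_; _,_)
open import Data.Sum using (_⊎_)
open import Data.Empty using (⊥)
open import Relation.Nullary using (¬_)
open import Relation.Binary.PropositionalEquality using (_≡_; _≢_)
open import Function using (flip)
open import Function.Bundles using (_↔_; _⇔_)
open import Function.Definitions using (Injective)

-- Vertex type V; E u v means there is an edge (u,v),
-- i.e. an edge directed from u to v.

record OrientedGraph (V : Set) : Set₁ where
  field
    E        : V → V → Set
    irrefl   : ∀ u → ¬ E u u
    oriented : ∀ u v → E u v → ¬ E v u
open OrientedGraph public

module _ {V : Set} (G : OrientedGraph V) where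

  CountablyInfinite : Set
  CountablyInfinite = V ↔ ℕ

  Adj : V → V → Set
  Adj u v = E G u v ⊎ E G v u

  data Walk : V → V → Set where
    here : ∀ {u} → Walk u u
    step : ∀ {u v w} → Adj u v → Walk v w → Walk u w

  WeaklyConnected : Set
  WeaklyConnected = ∀ u v → Walk u v

  data DirWalk⁺ : V → V → Set where
    one  : ∀ {u v} → E G u v → DirWalk⁺ u v
    more : ∀ {u v w} → E G u v → DirWalk⁺ v w → DirWalk⁺ u w

  Acyclic : Set
  Acyclic = ∀ u → ¬ DirWalk⁺ u u

  LocallyFinite : Set
  LocallyFinite = ∀ u → Σ (List V) λ xs → ∀ v → Adj u v → v ∈ xs

  OneWayInfDirPath : Set
  OneWayInfDirPath =
    Σ (ℕ → V) λ f → Injective _≡_ _≡_ f ×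
      ((∀ n → E G (f n) (f (suc n))) ⊎ (∀ n → E G (f (suc n)) (f n)))

  TwoWayInfDirPath : Set
  TwoWayInfDirPath =
    Σ (ℤ → V) λ f → Injective _≡_ _≡_ f × (∀ z → E G (f z) (f (sucℤ z)))

  NoInfiniteDirectedPath : Set
  NoInfiniteDirectedPath = ¬ OneWayInfDirPath × ¬ TwoWayInfDirPath

  InDegZero : V → Set
  InDegZero u = ∀ w → ¬ E G w u

  OutDegZero : V → Set
  OutDegZero u = ∀ w → ¬ E G u w

Odd : ℕ → Set
Odd n = n % 2 ≡ 1

Even : ℕ → Set
Even n = n % 2 ≡ 0

-- A partition {C_i : i ∈ ℕ} of V(G), ℕ = {1,2,...}, is given by the
-- index function  part : V → ℕ  with  part u ≢ 0 ; C_i = { u | part u ≡ i }.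
-- (C_0 = ∅ automatically.)

_∈C[_]_ : {V : Set} → V → (V → ℕ) → ℕ → Set
u ∈C[ part ] i = part u ≡ i

-- "w is in C_{i-1} ∪ C_{i+1}"
InNbrParts : {V : Set} → (V → ℕ) → V → ℕ → Set
InNbrParts part w i = suc (part w) ≡ i ⊎ part w ≡ suc i

record IsPMPartition {V : Set} (G : OrientedGraph V) (part : V → ℕ) : Set where
  field
    nonzero   : ∀ u → part u ≢ 0
    finite    : ∀ i → i ≢ 0 → Σ (List V) λ xs → ∀ u → u ∈C[ part ] i → u ∈ xs
    nonempty  : ∀ i → i ≢ 0 → ∃ λ u → u ∈C[ part ] i
    edges     : ∀ u v → E G u v →
                Σ ℕ λ i → i ≢ 0 ×
                  ((u ∈C[ part ] i ⊎ u ∈C[ part ] suc i) ×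
                   (v ∈C[ part ] i ⊎ v ∈C[ part ] suc i))
    oddNoIn   : ∀ i → Odd i → ∀ u → u ∈C[ part ] i →
                ∀ w → E G w u → ¬ InNbrParts part w i
    evenNoOut : ∀ i → i ≢ 0 → Even i → ∀ u → u ∈C[ part ] i →
                ∀ w → E G u w → ¬ InNbrParts part w i
    oddSource : ∀ i → Odd i →
                ∃ λ u → u ∈C[ part ] i × InDegZero G u
    evenSink  : ∀ i → i ≢ 0 → Even i →
                ∃ λ u → u ∈C[ part ] i × OutDegZero G u

reverse : {V : Set} → OrientedGraph V → OrientedGraph V
reverse G = record
  { E        = flip (E G)
  ; irrefl   = irrefl G
  ; oriented = λ u v e e' → oriented G v u e e'
  }

-- A ∓-partition: the same with "in" and "out" interchanged everywhere,
-- i.e. a ±-partition of the reversed graph.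
IsMPPartition : {V : Set} (G : OrientedGraph V) (part : V → ℕ) → Set
IsMPPartition G part = IsPMPartition (reverse G) part

FirstPartIs : {V : Set} → (V → ℕ) → V → Set
FirstPartIs part v = ∀ u → u ∈C[ part ] 1 ⇔ u ≡ v

{-# OPTIONS --safe #-}
-- Grow stages from v: stage 0 is {v}, and stage k + 1 adds every vertex
-- reachable from stage k along a directed path running forwards for even k
-- and backwards for odd k; a vertex lies in part C_(j+1) when stage j first
-- reaches it.  Every stage is closed under arcs against its own direction
-- (stage 0 because v is a source), which forces the arcs between consecutive
-- parts to point the required way.  By König's lemma every stage is finite,
-- so infinitude and connectivity make each stage add new vertices; among
-- these, one that is terminal against the current direction (it exists as
-- there are no infinite directed paths) is the source or sink required by
-- condition (4).  The ∓ case is the ± case of the reverse graph.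
module Submission where

open import Defs
open import Level using (0ℓ)
open import Axiom.ExcludedMiddle using (ExcludedMiddle)
open import Data.Nat using (ℕ)
open import Data.Product using (Σ; _×_)

open import Data.Bool using (Bool; true; false; not)
open import Data.Bool.Properties using (not-involutive)
open import Data.Empty using (⊥-elim)
open import Data.List using (List; []; _∷_; _++_; map)
open import Data.List.Extrema.Nat using (max; xs≤max)
open import Data.List.Membership.Propositional using (_∈_)
open import Data.List.Membership.Propositional.Properties
  using (∈-++⁺ˡ; ∈-++⁺ʳ; ∈-map⁺)
import Data.List.Relation.Unary.All as All
open import Data.List.Relation.Unary.Any using (here; there)
open import Data.Nat using (zero; suc; _≤_; _<_; z≤n; s≤s)
open import Data.Nat.Properties
  using (1+n≰n; ≰⇒>; <-cmp; ≤-antisym; ≤-total; n≤0⇒n≡0; suc-injective;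
         m≤n⇒m<n∨m≡n)
open import Data.Product using (_,_; proj₁; proj₂)
import Data.Sum as Sum
open import Data.Sum using (_⊎_; inj₁; inj₂)
open import Function using (flip; _∘_)
open import Function.Bundles using (_↔_; Inverse; mk⇔)
open import Function.Definitions using (Injective)
open import Relation.Binary.Construct.Closure.ReflexiveTransitive
  using (Star; ε; _◅_; _◅◅_)
open import Relation.Binary.Construct.Closure.Transitive
  using (TransClosure; _∷ʳ_) renaming ([_] to [_]⁺; _∷_ to _∷⁺_)
open import Relation.Binary.PropositionalEquality
  using (_≡_; _≢_; refl; sym; cong; subst; trans)
open import Relation.Binary.Definitions using (tri<; tri≈; tri>)
open import Relation.Nullary using (¬_; yes; no)
open import Relation.Nullary.Decidable using (decidable-stable)

module _ {A : Set} where

  Finite : (A → Set) → Set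
  Finite P = Σ (List A) λ xs → ∀ x → P x → x ∈ xs

  finite-⊆ : {P Q : A → Set} → (∀ {x} → P x → Q x) → Finite Q → Finite P
  finite-⊆ P⊆Q (xs , Q⊆xs) = xs , λ x p → Q⊆xs x (P⊆Q p)

  finite-⋃ : {B : Set} (ys : List B) {F : B → A → Set} →
             (∀ y → y ∈ ys → Finite (F y)) →
             Finite (λ x → Σ B λ y → y ∈ ys × F y x)
  finite-⋃ [] _ = [] , λ { _ (_ , () , _) }
  finite-⋃ (y ∷ ys) fin
    with fin y (here refl) | finite-⋃ ys (λ y′ m → fin y′ (there m))
  ... | (xs , F⊆xs) | (xs′ , ⋃⊆xs′) = xs ++ xs′ , λ
    { x (_ , here refl , f) → ∈-++⁺ˡ (F⊆xs x f)
    ; x (y′ , there m , f)  → ∈-++⁺ʳ xs (⋃⊆xs′ x (y′ , m , f))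
    }

  ↔ℕ⇒¬listed : A ↔ ℕ → (xs : List A) → ¬ (∀ x → x ∈ xs)
  ↔ℕ⇒¬listed A↔ℕ xs all = 1+n≰n (All.lookup (xs≤max 0 ns) n∈ns)
    where
      open Inverse A↔ℕ
      ns : List ℕ
      ns = map to xs
      n : ℕ
      n = suc (max 0 ns)
      n∈ns : n ∈ ns
      n∈ns = subst (_∈ ns) (strictlyInverseˡ n) (∈-map⁺ to (all (from n)))

module _ (em : ExcludedMiddle 0ℓ) where

  classical : {P : Set} → ¬ ¬ P → P
  classical = decidable-stable em

  module _ {P : ℕ → Set} (upward : ∀ {n} → P n → P (suc n)) where

    upward-≤ : ∀ {m n} → m ≤ n → P m → P n
    upward-≤ {n = zero} z≤n p = p
    upward-≤ {n = suc n} m≤1+n p with m≤n⇒m<n∨m≡n m≤1+n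
    ... | inj₁ (s≤s m≤n) = upward (upward-≤ m≤n p)
    ... | inj₂ refl = p

    least : ∀ n → P n → Σ ℕ λ m → P m × (∀ j → P j → m ≤ j)
    least zero p = 0 , p , λ _ _ → z≤n
    least (suc n) p with em {P n}
    ... | yes p′ = least n p′
    ... | no ¬p = suc n , p , λ j pj → ≰⇒> (λ j≤n → ¬p (upward-≤ j≤n pj))

module _ {A : Set} where

  Chain : (A → A → Set) → (ℕ → A) → Set
  Chain R f = ∀ n → R (f n) (f (suc n))

  ChainFree : (A → A → Set) → Set
  ChainFree R = ∀ f → ¬ Chain R f

  FinitelyBranching : (A → A → Set) → Set
  FinitelyBranching R = ∀ x → Finite (R x)

  module _ {R : A → A → Set} where

    reverse⁺ : ∀ {x y} → TransClosure (flip R) x y → TransClosure R y x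
    reverse⁺ [ r ]⁺ = [ r ]⁺
    reverse⁺ (r ∷⁺ rs) = reverse⁺ rs ∷ʳ r

    chain⁺ : ∀ {f} → Chain R f → ∀ {m n} → m < n → TransClosure R (f m) (f n)
    chain⁺ c {m} {suc n} (s≤s m≤n) with m≤n⇒m<n∨m≡n m≤n
    ... | inj₁ m<n = chain⁺ c m<n ∷ʳ c n
    ... | inj₂ refl = [ c m ]⁺

    acyclic-chain-injective : (∀ x → ¬ TransClosure R x x) →
                              ∀ {f} → Chain R f → Injective _≡_ _≡_ f
    acyclic-chain-injective acyclic {f} c {m} {n} fm≡fn with <-cmp m n
    ... | tri< m<n _ _ = ⊥-elim (acyclic (f n)
                           (subst (λ x → TransClosure R x (f n)) fm≡fn (chain⁺ c m<n)))
    ... | tri≈ _ m≡n _ = m≡n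
    ... | tri> _ _ n<m = ⊥-elim (acyclic (f m)
                           (subst (λ x → TransClosure R x (f m)) (sym fm≡fn) (chain⁺ c n<m)))

    -- Dependent choice, made constructive by the witnesses in the hypothesis.
    progressive-empty : ChainFree R → (S : A → Set) →
                        (∀ x → S x → Σ A λ y → S y × R x y) → ∀ x → ¬ S x
    progressive-empty chain-free S advance x s = chain-free (proj₁ ∘ walk) link
      where
        next : Σ A S → Σ A S
        next (y , sy) = proj₁ (advance y sy) , proj₁ (proj₂ (advance y sy))
        walk : ℕ → Σ A S
        walk zero = x , s
        walk (suc n) = next (walk n)
        link : Chain R (proj₁ ∘ walk)
        link n = proj₂ (proj₂ (advance _ (proj₂ (walk n))))

    module _ (em : ExcludedMiddle 0ℓ) (chain-free : ChainFree R) where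

      terminal-exists : (S : A → Set) → (∀ {x y} → S x → R x y → S y) →
                        ∀ {x} → S x → Σ A λ x → S x × (∀ y → ¬ R x y)
      terminal-exists S closed {x} s =
        classical em λ none → progressive-empty chain-free S (advance none) x s
        where
          advance : ¬ (Σ A λ x → S x × (∀ y → ¬ R x y)) →
                    ∀ x → S x → Σ A λ y → S y × R x y
          advance none x s =
            classical em λ stuck → none (x , s , λ y r → stuck (y , closed s r , r))

      successors-reach-finite : FinitelyBranching R → ∀ x →
        (∀ y → R x y → Finite (Star R y)) → Finite (Star R x)
      successors-reach-finite branching x fin =
        x ∷ zs , λ
          { _ ε → here refl
          ; z (r ◅ rs) → there (⋃⊆zs z (_ , R⊆ys _ r , r , rs))
          }
        where
          ys : List A
          ys = proj₁ (branching x)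
          R⊆ys : ∀ y → R x y → y ∈ ys
          R⊆ys = proj₂ (branching x)
          reach-through : ∀ y → y ∈ ys → Finite (λ z → R x y × Star R y z)
          reach-through y _ with em {R x y}
          ... | yes r = finite-⊆ proj₂ (fin y r)
          ... | no ¬r = [] , λ { _ (r , _) → ⊥-elim (¬r r) }
          zs : List A
          zs = proj₁ (finite-⋃ ys reach-through)
          ⋃⊆zs : ∀ z → (Σ A λ y → y ∈ ys × R x y × Star R y z) → z ∈ zs
          ⋃⊆zs = proj₂ (finite-⋃ ys reach-through)

      reach-finite : FinitelyBranching R → ∀ x → Finite (Star R x)
      reach-finite branching x =
        classical em λ ¬fin →
          progressive-empty chain-free (¬_ ∘ Finite ∘ Star R) advance x ¬fin
        where
          advance : ∀ x → ¬ Finite (Star R x) →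
                    Σ A λ y → ¬ Finite (Star R y) × R x y
          advance x ¬fin = classical em λ none → ¬fin
            (successors-reach-finite branching x λ y r →
              classical em λ ¬finy → none (y , ¬finy , r))

Arc : {V : Set} → OrientedGraph V → Bool → V → V → Set
Arc G true = E G
Arc G false = flip (E G)

module _ {V : Set} {G : OrientedGraph V} where

  arc-flip : ∀ b {x y} → Arc G (not b) x y → Arc G b y x
  arc-flip true a = a
  arc-flip false a = a

  adj⇒arc : ∀ b {x y} → Adj G x y → Arc G b x y ⊎ Arc G (not b) x y
  adj⇒arc true xy = xy
  adj⇒arc false xy = Sum.swap xy

  arcs-finitelyBranching : LocallyFinite G → ∀ b → FinitelyBranching (Arc G b)
  arcs-finitelyBranching lf true x = proj₁ (lf x) , λ y e → proj₂ (lf x) y (inj₁ e)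
  arcs-finitelyBranching lf false x = proj₁ (lf x) , λ y e → proj₂ (lf x) y (inj₂ e)

  acyclic⁺ : Acyclic G → ∀ x → ¬ TransClosure (E G) x x
  acyclic⁺ acyclic x = acyclic x ∘ toDirWalk⁺
    where
      toDirWalk⁺ : ∀ {x y} → TransClosure (E G) x y → DirWalk⁺ G x y
      toDirWalk⁺ [ e ]⁺ = one e
      toDirWalk⁺ (e ∷⁺ es) = more e (toDirWalk⁺ es)

  -- A two-way infinite directed path contains a one-way one, so only the
  -- first half of NoInfiniteDirectedPath is needed.
  arcs-chainFree : Acyclic G → NoInfiniteDirectedPath G → ∀ b → ChainFree (Arc G b)
  arcs-chainFree acyclic (no-path , _) true f c =
    no-path (f , acyclic-chain-injective (acyclic⁺ acyclic) c , inj₁ c)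
  arcs-chainFree acyclic (no-path , _) false f c =
    no-path (f , acyclic-chain-injective (λ x → acyclic⁺ acyclic x ∘ reverse⁺) c ,
             inj₂ c)

  reverse-arcs : {Q : (V → V → Set) → Set} →
                 (∀ b → Q (Arc G b)) → ∀ b → Q (Arc (reverse G) b)
  reverse-arcs q true = q false
  reverse-arcs q false = q true

  reverse-weaklyConnected : WeaklyConnected G → WeaklyConnected (reverse G)
  reverse-weaklyConnected conn u v = reverse-walk (conn u v)
    where
      reverse-walk : ∀ {u v} → Walk G u v → Walk (reverse G) u v
      reverse-walk here = here
      reverse-walk (step xy w) = step (Sum.swap xy) (reverse-walk w)

stageDir : ℕ → Bool
stageDir zero = true
stageDir (suc k) = not (stageDir k)

stageDir-odd : ∀ k → Odd (suc k) → stageDir k ≡ true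
stageDir-odd zero _ = refl
stageDir-odd (suc zero) ()
stageDir-odd (suc (suc k)) odd = trans (not-involutive _) (stageDir-odd k odd)

stageDir-even : ∀ k → Even (suc k) → stageDir k ≡ false
stageDir-even zero ()
stageDir-even (suc zero) _ = refl
stageDir-even (suc (suc k)) even = trans (not-involutive _) (stageDir-even k even)

between-suc : ∀ {m n} → m ≤ n → n ≤ suc m → n ≡ m ⊎ n ≡ suc m
between-suc m≤n n≤1+m with m≤n⇒m<n∨m≡n m≤n
... | inj₁ m<n = inj₂ (≤-antisym n≤1+m m<n)
... | inj₂ m≡n = inj₁ (sym m≡n)

module Layering (em : ExcludedMiddle 0ℓ) {V : Set} (G : OrientedGraph V)
  (cnt : CountablyInfinite G) (conn : WeaklyConnected G)
  (branching : ∀ b → FinitelyBranching (Arc G b))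
  (chain-free : ∀ b → ChainFree (Arc G b))
  (v : V) (v-source : InDegZero G v) where

  -- C₁ ∪ ⋯ ∪ C_(k+1)
  Reached : ℕ → V → Set
  Reached zero x = x ≡ v
  Reached (suc k) x = Σ V λ y → Reached k y × Star (Arc G (stageDir k)) y x

  reached-suc : ∀ {k x} → Reached k x → Reached (suc k) x
  reached-suc r = _ , r , ε

  reached-v : ∀ k → Reached k v
  reached-v zero = refl
  reached-v (suc k) = reached-suc (reached-v k)

  reached-along : ∀ {k x y} → Reached (suc k) x → Arc G (stageDir k) x y → Reached (suc k) y
  reached-along (z , r , rs) a = z , r , rs ◅◅ (a ◅ ε)

  reached-against : ∀ k {x y} → Reached k x → Arc G (not (stageDir k)) x y → Reached k y
  reached-against zero refl a = ⊥-elim (v-source _ a)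
  reached-against (suc k) r a =
    reached-along r (subst (λ b → Arc G b _ _) (not-involutive (stageDir k)) a)

  reached-adj : ∀ {k x y} → Reached k x → Adj G x y → Reached (suc k) y
  reached-adj {k} r xy with adj⇒arc (stageDir k) xy
  ... | inj₁ a = reached-along (reached-suc r) a
  ... | inj₂ a = reached-suc (reached-against k r a)

  reached-walk : ∀ {k x y} → Walk G x y → Reached k x → Σ ℕ λ j → Reached j y
  reached-walk {k} here r = k , r
  reached-walk (step xy w) r = reached-walk w (reached-adj r xy)

  reached-finite : ∀ k → Finite (Reached k)
  reached-finite zero = v ∷ [] , λ { _ refl → here refl }
  reached-finite (suc k) with reached-finite k
  ... | (xs , Reached⊆xs) =
    finite-⊆ (λ { (y , r , rs) → y , Reached⊆xs y r , rs })
      (finite-⋃ xs λ y _ →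
        reach-finite em (chain-free (stageDir k)) (branching (stageDir k)) y)

  -- C_(k+2)
  NewAt : ℕ → V → Set
  NewAt k x = Reached (suc k) x × ¬ Reached k x

  new-exists : ∀ k → Σ V (NewAt k)
  new-exists k = classical em λ none →
    ↔ℕ⇒¬listed cnt (proj₁ (reached-finite k)) λ x →
      proj₂ (reached-finite k) x (spread none (conn v x) (reached-v k))
    where
      spread : ¬ Σ V (NewAt k) → ∀ {x y} → Walk G x y → Reached k x → Reached k y
      spread none here r = r
      spread none (step xy w) r =
        spread none w (classical em λ ¬r → none (_ , reached-adj r xy , ¬r))

  new-against : ∀ k {x y} → NewAt k x → Arc G (not (stageDir (suc k))) x y → NewAt k y
  new-against k (r , ¬r) a =
    reached-against (suc k) r a ,
    λ r′ → ¬r (reached-against k r′ (arc-flip (not (stageDir k)) a))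

  new-terminal : ∀ k → Σ V λ x →
                 NewAt k x × (∀ y → ¬ Arc G (not (stageDir (suc k))) x y)
  new-terminal k =
    terminal-exists em (chain-free (not (stageDir (suc k)))) (NewAt k) (new-against k)
      (proj₂ (new-exists k))

  firstStage : ∀ x → Σ ℕ λ m → Reached m x × (∀ j → Reached j x → m ≤ j)
  firstStage x = least em reached-suc _ (proj₂ (reached-walk (conn v x) refl))

  level : V → ℕ
  level x = proj₁ (firstStage x)

  level-reached : ∀ x → Reached (level x) x
  level-reached x = proj₁ (proj₂ (firstStage x))

  level-minimal : ∀ {j x} → Reached j x → level x ≤ j
  level-minimal {j} {x} r = proj₂ (proj₂ (firstStage x)) j r

  level-v : level v ≡ 0
  level-v = n≤0⇒n≡0 (level-minimal refl)

  level-new : ∀ {k x} → NewAt k x → level x ≡ suc k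
  level-new {x = x} (r , ¬r) = ≤-antisym (level-minimal r)
    (≰⇒> λ level≤k → ¬r (upward-≤ em reached-suc level≤k (level-reached x)))

  level-adj : ∀ {x y} → Adj G x y → level x ≤ level y →
              level y ≡ level x ⊎ level y ≡ suc (level x)
  level-adj {x} xy x≤y =
    between-suc x≤y (level-minimal (reached-adj (level-reached x) xy))

  level-against : ∀ {x y} → Arc G (not (stageDir (level x))) x y → level y ≤ level x
  level-against {x} a = level-minimal (reached-against _ (level-reached x) a)

  part : V → ℕ
  part x = suc (level x)

  part-finite : ∀ i → i ≢ 0 → Finite (λ u → u ∈C[ part ] i)
  part-finite zero 0≢0 = ⊥-elim (0≢0 refl)
  part-finite (suc k) _ =
    finite-⊆ (λ {u} eq → subst (λ j → Reached j u) (suc-injective eq) (level-reached u))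
      (reached-finite k)

  part-nonempty : ∀ i → i ≢ 0 → Σ V λ u → u ∈C[ part ] i
  part-nonempty zero 0≢0 = ⊥-elim (0≢0 refl)
  part-nonempty (suc zero) _ = v , cong suc level-v
  part-nonempty (suc (suc k)) _ = let (x , new) = new-exists k in x , cong suc (level-new new)

  edge-parts : ∀ u w → E G u w → Σ ℕ λ i → i ≢ 0 ×
                 ((u ∈C[ part ] i ⊎ u ∈C[ part ] suc i) ×
                  (w ∈C[ part ] i ⊎ w ∈C[ part ] suc i))
  edge-parts u w e with ≤-total (level u) (level w)
  ... | inj₁ u≤w = part u , (λ ()) , inj₁ refl ,
                   Sum.map (cong suc) (cong suc) (level-adj (inj₁ e) u≤w)
  ... | inj₂ w≤u = part w , (λ ()) ,
                   Sum.map (cong suc) (cong suc) (level-adj (inj₂ e) w≤u) , inj₁ refl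

  no-arc-to-adjacent-part : ∀ {u w} → Arc G (not (stageDir (level u))) u w →
                            ¬ InNbrParts part w (part u)
  no-arc-to-adjacent-part {u} {w} a (inj₁ w-below) =
    1+n≰n (subst (_≤ level w) u-above (level-against w→u))
    where
      u-above : level u ≡ suc (level w)
      u-above = sym (suc-injective w-below)
      w→u : Arc G (not (stageDir (level w))) w u
      w→u = subst (λ b → Arc G b w u) (cong stageDir u-above) (arc-flip (stageDir (level u)) a)
  no-arc-to-adjacent-part {u} {w} a (inj₂ w-above) =
    1+n≰n (subst (_≤ level u) (suc-injective w-above) (level-against a))

  odd-no-in : ∀ i → Odd i → ∀ u → u ∈C[ part ] i →
              ∀ w → E G w u → ¬ InNbrParts part w i
  odd-no-in _ odd u refl w e = no-arc-to-adjacent-part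
    (subst (λ b → Arc G (not b) u w) (sym (stageDir-odd (level u) odd)) e)

  even-no-out : ∀ i → i ≢ 0 → Even i → ∀ u → u ∈C[ part ] i →
                ∀ w → E G u w → ¬ InNbrParts part w i
  even-no-out _ _ even u refl w e = no-arc-to-adjacent-part
    (subst (λ b → Arc G (not b) u w) (sym (stageDir-even (level u) even)) e)

  odd-source : ∀ i → Odd i → Σ V λ u → u ∈C[ part ] i × InDegZero G u
  odd-source zero ()
  odd-source (suc zero) _ = v , cong suc level-v , v-source
  odd-source (suc (suc k)) odd with new-terminal k | stageDir-odd (suc k) odd
  ... | x , new , terminal | dir≡ = x , cong suc (level-new new) ,
        λ w e → terminal w (subst (λ b → Arc G (not b) x w) (sym dir≡) e)

  even-sink : ∀ i → i ≢ 0 → Even i → Σ V λ u → u ∈C[ part ] i × OutDegZero G u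
  even-sink zero 0≢0 _ = ⊥-elim (0≢0 refl)
  even-sink (suc zero) _ ()
  even-sink (suc (suc k)) _ even with new-terminal k | stageDir-even (suc k) even
  ... | x , new , terminal | dir≡ = x , cong suc (level-new new) ,
        λ w e → terminal w (subst (λ b → Arc G (not b) x w) (sym dir≡) e)

  pm-partition : Σ (V → ℕ) λ part → IsPMPartition G part × FirstPartIs part v
  pm-partition = part , isPM , first
    where
      isPM : IsPMPartition G part
      isPM = record
        { nonzero = λ _ ()
        ; finite = part-finite
        ; nonempty = part-nonempty
        ; edges = edge-parts
        ; oddNoIn = odd-no-in
        ; evenNoOut = even-no-out
        ; oddSource = odd-source
        ; evenSink = even-sink
        }
      first : FirstPartIs part v
      first u = mk⇔ (λ eq → subst (λ j → Reached j u) (suc-injective eq) (level-reached u))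
                    (λ { refl → cong suc level-v })

lemma2p4 : ExcludedMiddle 0ℓ →
    {V : Set} (G : OrientedGraph V) →
    CountablyInfinite G → WeaklyConnected G → Acyclic G →
    LocallyFinite G → NoInfiniteDirectedPath G →
    (∀ v → InDegZero G v →
       Σ (V → ℕ) λ part → IsPMPartition G part × FirstPartIs part v) ×
    (∀ v → OutDegZero G v →
       Σ (V → ℕ) λ part → IsMPPartition G part × FirstPartIs part v)
lemma2p4 em G cnt conn acyclic lf no-path =
  Layering.pm-partition em G cnt conn branching chain-free ,
  Layering.pm-partition em (reverse G) cnt (reverse-weaklyConnected conn)
    (reverse-arcs {Q = FinitelyBranching} branching)
    (reverse-arcs {Q = ChainFree} chain-free)
  where
    branching : ∀ b → FinitelyBranching (Arc G b)
    branching = arcs-finitelyBranching lf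
    chain-free : ∀ b → ChainFree (Arc G b)
    chain-free = arcs-chainFree acyclic no-path
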